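{- Let $m\geq 8$ be even, let $t$ be an integer with $1\leq t\leq m/2-2$, and let $n$ be a positive integer with $n\equiv t+2 \pmod{m/2}$. Then $R(S_n(1,2t),W_m)\geq 2n+m/2-t-2$.
   Context: All graphs are finite, simple, undirected. For graphs $G,H$, the Ramsey number $R(G,H)$ is the smallest positive integer $N$ such that for every graph $F$ on $N$ vertices, either $F$ contains a subgraph isomorphic to $G$ or the complement $\overline{F}$ contains a subgraph isomorphic to $H$. $W_m$ is the wheel on $m+1$ vertices: a cycle $C_m$ plus one extra vertex adjacent to all vertices of the cycle. $S_k$ denotes the star on $k$ vertices. $S_n(l,s)$ denotes the tree of order $n$ obtained from the star $S_{n-sl}$ by subdividing each of $l$ chosen edges $s$ times. -}

module Defs where

open import Data.Nat using (ℕ; zero; suc; _+_; _*_; _∸_; _≤_; _<_)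
open import Data.Nat.Properties using (_≟_; _≤?_; _<?_)
open import Data.Bool using (Bool; true; false; _∧_; _∨_; not; if_then_else_)
open import Data.Fin using (Fin; toℕ)
open import Data.Product using (Σ; _×_; _,_)
open import Data.Sum using (_⊎_)
open import Function.Definitions using (Injective)
open import Relation.Binary.PropositionalEquality using (_≡_)
open import Relation.Nullary.Decidable using (⌊_⌋)

record Graph (n : ℕ) : Set where
  field
    adj   : Fin n → Fin n → Bool
    sym   : ∀ i j → adj i j ≡ adj j i
    irrefl : ∀ i → adj i i ≡ false
open Graph public

complement : ∀ {n} → Graph n → Graph n
complement {n} F = record
  { adj = λ i j → not ⌊ toℕ i ≟ toℕ j ⌋ ∧ not (adj F i j)
  ; sym = symC
  ; irrefl = irrC }
  where
  open import Relation.Binary.PropositionalEquality using (refl; cong₂; cong; sym)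
  open import Relation.Nullary using (yes; no)
  open import Data.Nat.Properties using (≟-diag)
  symC : ∀ i j → (not ⌊ toℕ i ≟ toℕ j ⌋ ∧ not (adj F i j)) ≡ (not ⌊ toℕ j ≟ toℕ i ⌋ ∧ not (adj F j i))
  symC i j with toℕ i ≟ toℕ j | toℕ j ≟ toℕ i
  ... | yes _ | yes _ = refl
  ... | no _  | no _  = cong not (Graph.sym F i j)
  ... | yes p | no q = Data.Empty.⊥-elim (q (Relation.Binary.PropositionalEquality.sym p))
    where import Data.Empty
  ... | no p | yes q = Data.Empty.⊥-elim (p (Relation.Binary.PropositionalEquality.sym q))
    where import Data.Empty
  irrC : ∀ i → (not ⌊ toℕ i ≟ toℕ i ⌋ ∧ not (adj F i i)) ≡ false
  irrC i rewrite ≟-diag {toℕ i} refl = refl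

_⊆G_ : ∀ {a b} → Graph a → Graph b → Set
_⊆G_ {a} {b} G F = Σ (Fin a → Fin b) λ f →
  Injective _≡_ _≡_ f × (∀ i j → adj G i j ≡ true → adj F (f i) (f j) ≡ true)

fromLt : ∀ n → (ℕ → ℕ → Bool) → Graph n
fromLt n r = record
  { adj = λ i j → a (toℕ i) (toℕ j)
  ; sym = λ i j → symA (toℕ i) (toℕ j)
  ; irrefl = λ i → irrA (toℕ i) }
  where
  open import Relation.Binary.PropositionalEquality using (refl)
  open import Relation.Nullary using (yes; no)
  open import Data.Nat.Properties using (<-asym; <-irrefl)
  import Data.Empty
  a : ℕ → ℕ → Bool
  a x y = if ⌊ x <? y ⌋ then r x y else (if ⌊ y <? x ⌋ then r y x else false)
  symA : ∀ x y → a x y ≡ a y x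
  symA x y with x <? y | y <? x
  ... | yes p | yes q = Data.Empty.⊥-elim (<-asym p q)
  ... | yes _ | no _ = refl
  ... | no _ | yes _ = refl
  ... | no _ | no _ = refl
  irrA : ∀ x → a x x ≡ false
  irrA x with x <? x
  ... | yes p = Data.Empty.⊥-elim (<-irrefl refl p)
  ... | no _ = refl

-- Wheel W_m on m+1 vertices: vertex 0 is the hub, vertices 1..m form the cycle C_m.
wheel : (m : ℕ) → Graph (suc m)
wheel m = fromLt (suc m) r
  where
  -- called only with i < j
  r : ℕ → ℕ → Bool
  r i j = ⌊ i ≟ 0 ⌋ ∨ ⌊ j ≟ suc i ⌋ ∨ (⌊ i ≟ 1 ⌋ ∧ ⌊ j ≟ m ⌋)

-- S_n(1,s): tree of order n obtained from the star S_{n-s} (center 0) by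
-- subdividing one edge s times.  Vertex 0 = center, vertices 1..s+1 form the
-- path 0-1-2-...-(s+1), vertices s+2..n-1 are leaves adjacent to 0.
-- (Meaningful when s + 2 ≤ n, i.e. the star S_{n-s} has at least one edge.)
spider1 : (n s : ℕ) → Graph n
spider1 n s = fromLt n r
  where
  r : ℕ → ℕ → Bool
  r i j = (⌊ j ≤? suc s ⌋ ∧ ⌊ j ≟ suc i ⌋) ∨ (⌊ i ≟ 0 ⌋ ∧ ⌊ suc (suc s) ≤? j ⌋)

Arrows : ∀ {a b} → ℕ → Graph a → Graph b → Set
Arrows N G H = (F : Graph N) → G ⊆G F ⊎ H ⊆G complement F

-- R(G,H) ≥ K : the least N with Arrows N G H is at least K,
-- i.e. every N with Arrows N G H satisfies K ≤ N.
RamseyGeq : ∀ {a b} → Graph a → Graph b → ℕ → Set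
RamseyGeq G H K = ∀ N → Arrows N G H → K ≤ N

-- Write k = m/2 and n = t + 2 + j k, and let F be the disjoint union of a clique B on
-- p = n - 1 vertices and a complete multipartite graph A with at most j + 1 parts of
-- size k, on N ≤ 2n + k - t - 3 vertices in total.  The spider is connected, so it
-- lies inside B (too few vertices) or inside A.  Inside A, the part of the centre can
-- only host the centre and path vertices no two of which are consecutive, at most
-- t + 1 vertices; the other j parts host at most j k, and t + 1 + j k < n.  In the
-- complement, B is independent, A is a disjoint union of k-cliques and every B-A pair
-- is an edge.  A hub in B forces the rim into one k-clique; a hub in A forces one vertex
-- of each of k disjoint pairs of consecutive rim vertices into the hub's k-clique.
module Submission where

open import Data.Bool using (Bool; true; false; _∧_; not; if_then_else_)
open import Data.Bool.Properties using (∨-zeroʳ)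
open import Data.Empty using (⊥-elim)
open import Data.Fin using (Fin; toℕ; fromℕ<) renaming (zero to fzero; suc to fsuc)
open import Data.Fin.Properties using (toℕ-fromℕ<; fromℕ<-toℕ; toℕ<n; toℕ-injective; injective⇒≤)
open import Data.Nat using (ℕ; zero; suc; _+_; _*_; _∸_; _≤_; _<_; NonZero; z≤n; s≤s; z<s; ⌊_/2⌋; >-nonZero⁻¹)
open import Data.Nat.Divisibility using (_∣_)
open import Data.Nat.DivMod using (_/_; _%_; m≡m%n+[m/n]*n; m%n<n; /-monoˡ-≤; m/n*n≡m; m<n*o⇒m/o<n)
open import Data.Nat.Properties
open import Data.Nat.Tactic.RingSolver using (solve-∀)
open import Data.Product using (Σ-syntax; _×_; _,_; proj₁; proj₂; uncurry; map₁)
open import Data.Sum using ([_,_]′)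
open import Function using (_∘_)
open import Function.Definitions using (Injective)
open import Relation.Binary using (tri<; tri≈; tri>)
open import Relation.Binary.PropositionalEquality
open import Relation.Nullary using (¬_; yes; no)
open import Relation.Nullary.Decidable using (⌊_⌋)
open import Defs hiding (sym)

⌊1+n+n/2⌋≡n : ∀ n → ⌊ suc (n + n) /2⌋ ≡ n
⌊1+n+n/2⌋≡n zero    = refl
⌊1+n+n/2⌋≡n (suc n) = cong suc (trans (cong ⌊_/2⌋ (+-suc n n)) (⌊1+n+n/2⌋≡n n))

m≤1+2n⇒⌊m/2⌋≤n : ∀ {m} n → m ≤ suc (2 * n) → ⌊ m /2⌋ ≤ n
m≤1+2n⇒⌊m/2⌋≤n n m≤ rewrite +-identityʳ n = ≤-trans (⌊n/2⌋-mono m≤) (≤-reflexive (⌊1+n+n/2⌋≡n n))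

m<n∧⌊m/2⌋≡⌊n/2⌋⇒n≡1+m : ∀ {m n} → m < n → ⌊ m /2⌋ ≡ ⌊ n /2⌋ → n ≡ suc m
m<n∧⌊m/2⌋≡⌊n/2⌋⇒n≡1+m {zero}        {suc zero}    _ _ = refl
m<n∧⌊m/2⌋≡⌊n/2⌋⇒n≡1+m {zero}        {suc (suc _)} _ ()
m<n∧⌊m/2⌋≡⌊n/2⌋⇒n≡1+m {suc zero}    {suc zero}    (s≤s ()) _
m<n∧⌊m/2⌋≡⌊n/2⌋⇒n≡1+m {suc zero}    {suc (suc _)} _ ()
m<n∧⌊m/2⌋≡⌊n/2⌋⇒n≡1+m {suc (suc _)} {suc zero}    (s≤s ()) _
m<n∧⌊m/2⌋≡⌊n/2⌋⇒n≡1+m {suc (suc m)} {suc (suc n)} (s≤s (s≤s m<n)) eq =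
  cong (suc ∘ suc) (m<n∧⌊m/2⌋≡⌊n/2⌋⇒n≡1+m m<n (suc-injective eq))

⌊≟⌋-sym : ∀ x y → ⌊ x ≟ y ⌋ ≡ ⌊ y ≟ x ⌋
⌊≟⌋-sym x y with x ≟ y | y ≟ x
... | yes _   | yes _   = refl
... | no _    | no _    = refl
... | yes x≡y | no y≢x  = ⊥-elim (y≢x (sym x≡y))
... | no x≢y  | yes y≡x = ⊥-elim (x≢y (sym y≡x))

*+-injective : ∀ k {a b r s} → r < k → s < k → a * k + r ≡ b * k + s → a ≡ b × r ≡ s
*+-injective k {zero}  {zero}  _   _   eq = refl , eq
*+-injective k {zero}  {suc b} r<k _   eq =
  ⊥-elim (<⇒≱ r<k (≤-trans (m≤m+n k (b * k)) (≤-trans (m≤m+n _ _) (≤-reflexive (sym eq)))))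
*+-injective k {suc a} {zero}  _   s<k eq =
  ⊥-elim (<⇒≱ s<k (≤-trans (m≤m+n k (a * k)) (≤-trans (m≤m+n _ _) (≤-reflexive eq))))
*+-injective k {suc a} {suc b} r<k s<k eq = map₁ (cong suc) (*+-injective k r<k s<k
  (+-cancelˡ-≡ k _ _ (trans (sym (+-assoc k (a * k) _)) (trans eq (+-assoc k (b * k) _)))))

m%k≡n%k⇒n≡m+[n/k∸m/k]*k : ∀ {m n} k .{{_ : NonZero k}} → m ≤ n → n % k ≡ m % k →
                          n ≡ m + (n / k ∸ m / k) * k
m%k≡n%k⇒n≡m+[n/k∸m/k]*k {m} {n} k m≤n n%k≡m%k = begin
  n                                ≡⟨ m≡m%n+[m/n]*n n k ⟩
  n % k + n / k * k                ≡⟨ cong₂ (λ r q → r + q * k) n%k≡m%k (sym (m+[n∸m]≡n (/-monoˡ-≤ k m≤n))) ⟩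
  m % k + (m / k + d) * k          ≡⟨ cong (m % k +_) (*-distribʳ-+ k (m / k) d) ⟩
  m % k + (m / k * k + d * k)      ≡⟨ sym (+-assoc (m % k) _ _) ⟩
  m % k + m / k * k + d * k        ≡⟨ cong (_+ d * k) (sym (m≡m%n+[m/n]*n m k)) ⟩
  m + d * k                        ∎
  where
  open ≡-Reasoning
  d = n / k ∸ m / k

transpose : ℕ → ℕ → ℕ → ℕ
transpose a b x = if ⌊ x ≟ a ⌋ then b else if ⌊ x ≟ b ⌋ then a else x

transpose-injective : ∀ a b {x y} → transpose a b x ≡ transpose a b y → x ≡ y
transpose-injective a b {x} {y} eq with x ≟ a | x ≟ b | y ≟ a | y ≟ b
... | yes x≡a | _       | yes y≡a | _       = trans x≡a (sym y≡a)
... | yes _   | _       | no y≢a  | yes y≡b = ⊥-elim (y≢a (trans y≡b eq))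
... | yes _   | _       | no _    | no y≢b  = ⊥-elim (y≢b (sym eq))
... | no x≢a  | yes x≡b | yes _   | _       = ⊥-elim (x≢a (trans x≡b (sym eq)))
... | no _    | no x≢b  | yes _   | _       = ⊥-elim (x≢b eq)
... | no _    | yes x≡b | no _    | yes y≡b = trans x≡b (sym y≡b)
... | no _    | yes _   | no y≢a  | no _    = ⊥-elim (y≢a (sym eq))
... | no x≢a  | no _    | no _    | yes _   = ⊥-elim (x≢a eq)
... | no _    | no _    | no _    | no _    = eq

transpose-< : ∀ {a b x} → a ≤ b → x ≤ b → x ≢ a → transpose a b x < b
transpose-< {a} {b} {x} a≤b x≤b x≢a with x ≟ a | x ≟ b
... | yes x≡a | _       = ⊥-elim (x≢a x≡a)
... | no _    | yes x≡b = ≤∧≢⇒< a≤b (λ a≡b → x≢a (trans x≡b (sym a≡b)))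
... | no _    | no x≢b  = ≤∧≢⇒< x≤b x≢b

injective-bounded⇒≤ : ∀ {a b} (g : Fin a → ℕ) → (∀ i → g i < b) → Injective _≡_ _≡_ g → a ≤ b
injective-bounded⇒≤ g g<b g-inj = injective⇒≤ {f = λ i → fromℕ< (g<b i)} λ {i} {i'} eq →
  g-inj (trans (sym (toℕ-fromℕ< (g<b i))) (trans (cong toℕ eq) (toℕ-fromℕ< (g<b i'))))

complement-adj : ∀ {n} (F : Graph n) u v → adj (complement F) u v ≡ true →
                 toℕ u ≢ toℕ v × adj F u v ≡ false
complement-adj F u v e with toℕ u ≟ toℕ v | adj F u v
complement-adj F u v () | yes _   | _
complement-adj F u v () | no _    | true
complement-adj F u v _  | no u≢v  | false = u≢v , refl

spider1-path-edge : ∀ {n} s (u v : Fin n) → toℕ v ≡ suc (toℕ u) → toℕ v ≤ suc s →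
                    adj (spider1 n s) u v ≡ true
spider1-path-edge s u v v≡1+u v≤ with toℕ u <? toℕ v | toℕ v ≤? suc s | toℕ v ≟ suc (toℕ u)
... | yes _ | yes _ | yes _  = refl
... | no u≮v | _    | _      = ⊥-elim (u≮v (≤-reflexive (sym v≡1+u)))
... | yes _ | no v≰ | _      = ⊥-elim (v≰ v≤)
... | yes _ | yes _ | no v≢  = ⊥-elim (v≢ v≡1+u)

spider1-leaf-edge : ∀ {n} s (u v : Fin n) → toℕ u ≡ 0 → suc (suc s) ≤ toℕ v →
                    adj (spider1 n s) u v ≡ true
spider1-leaf-edge s u v u≡0 leaf with toℕ u <? toℕ v | toℕ u ≟ 0 | suc (suc s) ≤? toℕ v
... | yes _  | yes _ | yes _ = ∨-zeroʳ _
... | no u≮v | _     | _     = ⊥-elim (u≮v (subst (_< toℕ v) (sym u≡0) (≤-trans z<s leaf)))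
... | yes _  | no u≢ | _     = ⊥-elim (u≢ u≡0)
... | yes _  | yes _ | no ¬leaf = ⊥-elim (¬leaf leaf)

spider1-connected : ∀ {n} s (Q : Fin (suc n) → Set) →
                    (∀ u v → adj (spider1 (suc n) s) u v ≡ true → Q u → Q v) →
                    Q fzero → ∀ i → Q i
spider1-connected {n} s Q step Q-centre i with toℕ i ≤? suc s
... | yes i≤ = subst Q (fromℕ<-toℕ i (toℕ<n i)) (along-path (toℕ i) (toℕ<n i) i≤)
  where
  along-path : ∀ x (x<n : x < suc n) → x ≤ suc s → Q (fromℕ< x<n)
  along-path zero    _     _    = Q-centre
  along-path (suc x) x+1<n x+1≤ =
    step _ _ (spider1-path-edge s _ _ consecutive (subst (_≤ suc s) (sym (toℕ-fromℕ< x+1<n)) x+1≤))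
      (along-path x x<n (≤-trans (n≤1+n x) x+1≤))
    where
    x<n : x < suc n
    x<n = <-trans (n<1+n x) x+1<n
    consecutive : toℕ (fromℕ< x+1<n) ≡ suc (toℕ (fromℕ< x<n))
    consecutive = trans (toℕ-fromℕ< x+1<n) (cong suc (sym (toℕ-fromℕ< x<n)))
... | no i≰ = step fzero i (spider1-leaf-edge s fzero i refl (≰⇒> i≰)) Q-centre

wheel-hub-edge : ∀ m (v : Fin (suc m)) → 0 < toℕ v → adj (wheel m) fzero v ≡ true
wheel-hub-edge m v 0<v with 0 <? toℕ v
... | yes _   = refl
... | no 0≮v  = ⊥-elim (0≮v 0<v)

wheel-rim-edge : ∀ m (u v : Fin (suc m)) → toℕ v ≡ suc (toℕ u) → adj (wheel m) u v ≡ true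
wheel-rim-edge m u v v≡1+u with toℕ u <? toℕ v | toℕ v ≟ suc (toℕ u)
... | yes _  | yes _ = ∨-zeroʳ _
... | no u≮v | _     = ⊥-elim (u≮v (≤-reflexive (sym v≡1+u)))
... | yes _  | no v≢ = ⊥-elim (v≢ v≡1+u)

critical-graphs⇒RamseyGeq : ∀ {a b} {G : Graph a} {H : Graph b} {K} →
  (∀ N → N < K → Σ[ F ∈ Graph N ] ¬ G ⊆G F × ¬ H ⊆G complement F) → RamseyGeq G H K
critical-graphs⇒RamseyGeq {K = K} critical N arrows with K ≤? N
... | yes K≤N = K≤N
... | no K≰N with critical N (≰⇒> K≰N)
...   | F , G⊈F , H⊈F̄ = ⊥-elim ([ G⊈F , H⊈F̄ ]′ (arrows F))

-- Vertices x < p form the clique; a vertex x ≥ p lies in part (x - p) / k of the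
-- complete multipartite graph, at position slot x within its part.
module CliqueAndMultipartite (p k : ℕ) .{{_ : NonZero k}} where

  part slot : ℕ → ℕ
  part x = (x ∸ p) / k
  slot x = (x ∸ p) % k

  adjacent : ℕ → ℕ → Bool
  adjacent x y = if ⌊ x <? p ⌋ then ⌊ y <? p ⌋ ∧ not ⌊ x ≟ y ⌋
                 else not ⌊ y <? p ⌋ ∧ not ⌊ part x ≟ part y ⌋

  adjacent-sym : ∀ x y → adjacent x y ≡ adjacent y x
  adjacent-sym x y with x <? p | y <? p
  ... | yes _ | yes _ = cong not (⌊≟⌋-sym x y)
  ... | yes _ | no _  = refl
  ... | no _  | yes _ = refl
  ... | no _  | no _  = cong not (⌊≟⌋-sym (part x) (part y))

  adjacent-irrefl : ∀ x → adjacent x x ≡ false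
  adjacent-irrefl x with x <? p
  ... | yes _ rewrite ≟-diag {x} refl = refl
  ... | no _  rewrite ≟-diag {part x} refl = refl

  graph : (N : ℕ) → Graph N
  graph N = record
    { adj    = λ u v → adjacent (toℕ u) (toℕ v)
    ; sym    = λ u v → adjacent-sym (toℕ u) (toℕ v)
    ; irrefl = λ u → adjacent-irrefl (toℕ u)
    }

  edge-from-clique : ∀ {x y} → adjacent x y ≡ true → x < p → y < p
  edge-from-clique {x} {y} e x<p with x <? p | y <? p
  edge-from-clique _  _   | yes _   | yes y<p = y<p
  edge-from-clique () _   | yes _   | no _
  edge-from-clique _  x<p | no x≮p  | _       = ⊥-elim (x≮p x<p)

  edge-outside-clique : ∀ {x y} → adjacent x y ≡ true → p ≤ x → p ≤ y × part x ≢ part y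
  edge-outside-clique {x} {y} e p≤x with x <? p | y <? p | part x ≟ part y
  edge-outside-clique _  p≤x | yes x<p | _       | _         = ⊥-elim (<⇒≱ x<p p≤x)
  edge-outside-clique () _   | no _    | yes _   | _
  edge-outside-clique () _   | no _    | no _    | yes _
  edge-outside-clique _  _   | no _    | no y≮p  | no parts≢ = ≮⇒≥ y≮p , parts≢

  non-edge-from-clique : ∀ {x y} → x ≢ y → adjacent x y ≡ false → x < p → p ≤ y
  non-edge-from-clique {x} {y} x≢y e x<p with x <? p | y <? p | x ≟ y
  non-edge-from-clique _   _  x<p | no x≮p | _      | _       = ⊥-elim (x≮p x<p)
  non-edge-from-clique _   _  _   | yes _  | no y≮p | _       = ≮⇒≥ y≮p
  non-edge-from-clique x≢y _  _   | yes _  | yes _  | yes x≡y = ⊥-elim (x≢y x≡y)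
  non-edge-from-clique _   () _   | yes _  | yes _  | no _

  non-edge-outside-clique : ∀ {x y} → adjacent x y ≡ false → p ≤ x → p ≤ y → part x ≡ part y
  non-edge-outside-clique {x} {y} e p≤x p≤y with x <? p | y <? p | part x ≟ part y
  non-edge-outside-clique _  p≤x _   | yes x<p | _       | _         = ⊥-elim (<⇒≱ x<p p≤x)
  non-edge-outside-clique _  _   p≤y | no _    | yes y<p | _         = ⊥-elim (<⇒≱ y<p p≤y)
  non-edge-outside-clique _  _   _   | no _    | no _    | yes parts≡ = parts≡
  non-edge-outside-clique () _   _   | no _    | no _    | no _

  co-edge-from-clique : ∀ {N} {u v : Fin N} → adj (complement (graph N)) u v ≡ true →
                        toℕ u < p → p ≤ toℕ v
  co-edge-from-clique {u = u} {v} e = uncurry non-edge-from-clique (complement-adj (graph _) u v e)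

  co-edge-outside-clique : ∀ {N} {u v : Fin N} → adj (complement (graph N)) u v ≡ true →
                           p ≤ toℕ u → p ≤ toℕ v → part (toℕ u) ≡ part (toℕ v)
  co-edge-outside-clique {u = u} {v} e = non-edge-outside-clique (proj₂ (complement-adj (graph _) u v e))

  part-slot-injective : ∀ {x y} → p ≤ x → p ≤ y → part x ≡ part y → slot x ≡ slot y → x ≡ y
  part-slot-injective {x} {y} p≤x p≤y parts≡ slots≡ = begin
    x              ≡⟨ sym (m∸n+n≡m p≤x) ⟩
    x ∸ p + p      ≡⟨ cong (_+ p) offsets≡ ⟩
    y ∸ p + p      ≡⟨ m∸n+n≡m p≤y ⟩
    y              ∎
    where
    open ≡-Reasoning
    offsets≡ : x ∸ p ≡ y ∸ p
    offsets≡ = begin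
      x ∸ p              ≡⟨ m≡m%n+[m/n]*n (x ∸ p) k ⟩
      slot x + part x * k ≡⟨ cong₂ (λ r q → r + q * k) slots≡ parts≡ ⟩
      slot y + part y * k ≡⟨ sym (m≡m%n+[m/n]*n (y ∸ p) k) ⟩
      y ∸ p              ∎

  part-< : ∀ {x q} → p ≤ x → x < p + q * k → part x < q
  part-< {x} {q} p≤x x< = m<n*o⇒m/o<n (subst (x ∸ p <_) (m+n∸m≡n p (q * k)) (∸-monoˡ-< x< p≤x))

  part-size-≤ : ∀ {a q} (g : Fin a → ℕ) → Injective _≡_ _≡_ g →
                (∀ i → p ≤ g i) → (∀ i → part (g i) ≡ q) → a ≤ k
  part-size-≤ g g-inj p≤g part≡q = injective-bounded⇒≤ (slot ∘ g) (λ i → m%n<n (g i ∸ p) k)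
    λ {i} {i'} → g-inj ∘ part-slot-injective (p≤g i) (p≤g i') (trans (part≡q i) (sym (part≡q i')))

  module WheelEmbedding {m N : ℕ} (k+k≤m : k + k ≤ m) (w : Fin (suc m) → Fin N)
    (w-inj : Injective _≡_ _≡_ w)
    (w-edge : ∀ u v → adj (wheel m) u v ≡ true → adj (complement (graph N)) (w u) (w v) ≡ true) where

    W : Fin (suc m) → ℕ
    W = toℕ ∘ w

    W-injective : Injective _≡_ _≡_ W
    W-injective = w-inj ∘ toℕ-injective

    rim : ∀ x → .(x < m) → Fin (suc m)
    rim x x<m = fromℕ< (s≤s x<m)

    toℕ-rim : ∀ {x} (x<m : x < m) → toℕ (rim x x<m) ≡ suc x
    toℕ-rim x<m = toℕ-fromℕ< (s≤s x<m)

    hub-co-edge : ∀ v → 0 < toℕ v → adj (complement (graph N)) (w fzero) (w v) ≡ true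
    hub-co-edge v 0<v = w-edge fzero v (wheel-hub-edge m v 0<v)

    rim-co-edge : ∀ {x} (x<m : x < m) (x+1<m : suc x < m) →
                  adj (complement (graph N)) (w (rim x x<m)) (w (rim (suc x) x+1<m)) ≡ true
    rim-co-edge x<m x+1<m = w-edge _ _ (wheel-rim-edge m _ _ (trans (toℕ-rim x+1<m) (cong suc (sym (toℕ-rim x<m)))))

    k<m : k < m
    k<m = ≤-trans (subst (_≤ k + k) (+-comm k 1) (+-monoʳ-≤ k (>-nonZero⁻¹ k))) k+k≤m

    1+s+s<m : ∀ {s} → s < k → suc (s + s) < m
    1+s+s<m {s} s<k = ≤-trans (≤-reflexive (cong suc (sym (+-suc s s)))) (≤-trans (+-mono-≤ s<k s<k) k+k≤m)

    s+s<m : ∀ {s} → s < k → s + s < m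
    s+s<m s<k = <-trans (n<1+n _) (1+s+s<m s<k)

    hub-not-in-clique : ¬ W fzero < p
    hub-not-in-clique hub<p = n≮n k (part-size-≤ g g-injective (λ i → rim-outside (index<m i)) (λ i → rim-part (index<m i)))
      where
      rim-outside : ∀ {x} (x<m : x < m) → p ≤ W (rim x x<m)
      rim-outside x<m = co-edge-from-clique (hub-co-edge _ (subst (0 <_) (sym (toℕ-rim x<m)) z<s)) hub<p

      0<m : 0 < m
      0<m = ≤-<-trans z≤n k<m

      rim-part : ∀ {x} (x<m : x < m) → part (W (rim x x<m)) ≡ part (W (rim 0 0<m))
      rim-part {zero}  _     = refl
      rim-part {suc x} x+1<m =
        trans (sym (co-edge-outside-clique (rim-co-edge x<m x+1<m) (rim-outside x<m) (rim-outside x+1<m)))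
              (rim-part x<m)
        where
        x<m : x < m
        x<m = <-trans (n<1+n x) x+1<m

      index<m : (i : Fin (suc k)) → toℕ i < m
      index<m i = ≤-<-trans (≤-pred (toℕ<n i)) k<m

      g : Fin (suc k) → ℕ
      g i = W (rim (toℕ i) (index<m i))

      g-injective : Injective _≡_ _≡_ g
      g-injective {i} {i'} eq = toℕ-injective (suc-injective (begin
        suc (toℕ i)                      ≡⟨ sym (toℕ-rim (index<m i)) ⟩
        toℕ (rim (toℕ i) (index<m i))    ≡⟨ cong toℕ (W-injective eq) ⟩
        toℕ (rim (toℕ i') (index<m i'))  ≡⟨ toℕ-rim (index<m i') ⟩
        suc (toℕ i')                     ∎))
        where open ≡-Reasoning

    record RimChoice (s : ℕ) : Set where
      field
        vertex  : Fin (suc m)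
        on-rim  : 0 < toℕ vertex
        pair    : ⌊ toℕ vertex ∸ 1 /2⌋ ≡ s
        outside : p ≤ W vertex

    -- Rim vertices 2s + 1 and 2s + 2 are adjacent in the complement, so they are not both in the clique.
    rim-choice : ∀ s → s < k → RimChoice s
    rim-choice s s<k with W (rim (s + s) (s+s<m s<k)) <? p
    ... | no s+s∉B = record
      { vertex  = rim (s + s) (s+s<m s<k)
      ; on-rim  = subst (0 <_) (sym (toℕ-rim (s+s<m s<k))) z<s
      ; pair    = trans (cong (λ x → ⌊ x ∸ 1 /2⌋) (toℕ-rim (s+s<m s<k))) (sym (n≡⌊n+n/2⌋ s))
      ; outside = ≮⇒≥ s+s∉B
      }
    ... | yes s+s∈B = record
      { vertex  = rim (suc (s + s)) (1+s+s<m s<k)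
      ; on-rim  = subst (0 <_) (sym (toℕ-rim (1+s+s<m s<k))) z<s
      ; pair    = trans (cong (λ x → ⌊ x ∸ 1 /2⌋) (toℕ-rim (1+s+s<m s<k))) (⌊1+n+n/2⌋≡n s)
      ; outside = co-edge-from-clique (rim-co-edge (s+s<m s<k) (1+s+s<m s<k)) s+s∈B
      }

    hub-not-outside-clique : ¬ p ≤ W fzero
    hub-not-outside-clique p≤hub = n≮n k (part-size-≤ g g-injective p≤g g-part)
      where
      choice : (i : Fin k) → RimChoice (toℕ i)
      choice i = rim-choice (toℕ i) (toℕ<n i)
      open RimChoice

      g : Fin (suc k) → ℕ
      g fzero    = W fzero
      g (fsuc i) = W (vertex (choice i))

      g-injective : Injective _≡_ _≡_ g
      g-injective {fzero}  {fzero}   _  = refl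
      g-injective {fzero}  {fsuc i'} eq = ⊥-elim (<-irrefl (cong toℕ (W-injective eq)) (on-rim (choice i')))
      g-injective {fsuc i} {fzero}   eq = ⊥-elim (<-irrefl (cong toℕ (W-injective (sym eq))) (on-rim (choice i)))
      g-injective {fsuc i} {fsuc i'} eq = cong fsuc (toℕ-injective (begin
        toℕ i                                    ≡⟨ sym (pair (choice i)) ⟩
        ⌊ toℕ (vertex (choice i)) ∸ 1 /2⌋        ≡⟨ cong (λ v → ⌊ toℕ v ∸ 1 /2⌋) (W-injective eq) ⟩
        ⌊ toℕ (vertex (choice i')) ∸ 1 /2⌋       ≡⟨ pair (choice i') ⟩
        toℕ i'                                   ∎))
        where open ≡-Reasoning

      p≤g : ∀ i → p ≤ g i
      p≤g fzero    = p≤hub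
      p≤g (fsuc i) = outside (choice i)

      g-part : ∀ i → part (g i) ≡ part (W fzero)
      g-part fzero    = refl
      g-part (fsuc i) = sym (co-edge-outside-clique (hub-co-edge _ (on-rim (choice i))) p≤hub (outside (choice i)))

  wheel-free : ∀ {m N} → 2 * k ≤ m → ¬ (wheel m ⊆G complement (graph N))
  wheel-free {m} 2k≤m (w , w-inj , w-edge) = hub-not-outside-clique (≮⇒≥ hub-not-in-clique)
    where
    open WheelEmbedding (subst (λ z → k + z ≤ m) (+-identityʳ k) 2k≤m) w w-inj w-edge

module SpiderFree (k t j : ℕ) .{{_ : NonZero k}} (t<k : t < k) where

  p : ℕ
  p = suc (t + j * k)

  open CliqueAndMultipartite p k

  module SpiderEmbedding {N : ℕ} (N≤ : N ≤ p + suc j * k) (f : Fin (suc p) → Fin N)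
    (f-inj : Injective _≡_ _≡_ f)
    (f-edge : ∀ u v → adj (spider1 (suc p) (2 * t)) u v ≡ true → adj (graph N) (f u) (f v) ≡ true) where

    F : Fin (suc p) → ℕ
    F = toℕ ∘ f

    F-injective : Injective _≡_ _≡_ F
    F-injective = f-inj ∘ toℕ-injective

    centre-not-in-clique : ¬ F fzero < p
    centre-not-in-clique centre<p = n≮n p (injective-bounded⇒≤ F all-in-clique F-injective)
      where
      all-in-clique : ∀ i → F i < p
      all-in-clique = spider1-connected (2 * t) (λ i → F i < p) (λ u v → edge-from-clique ∘ f-edge u v) centre<p

    centre-not-outside-clique : ¬ p ≤ F fzero
    centre-not-outside-clique p≤centre = n≮n p (injective-bounded⇒≤ code code-< code-injective)
      where
      all-outside : ∀ i → p ≤ F i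
      all-outside = spider1-connected (2 * t) (λ i → p ≤ F i) (λ u v e → proj₁ ∘ edge-outside-clique (f-edge u v e)) p≤centre

      edge-crosses-parts : ∀ u v → adj (spider1 (suc p) (2 * t)) u v ≡ true → part (F u) ≢ part (F v)
      edge-crosses-parts u v e = proj₂ (edge-outside-clique (f-edge u v e) (all-outside u))

      q₀ : ℕ
      q₀ = part (F fzero)

      part< : ∀ i → part (F i) < suc j
      part< i = part-< (all-outside i) (<-≤-trans (toℕ<n (f i)) N≤)

      central-on-path : ∀ i → part (F i) ≡ q₀ → toℕ i ≤ suc (2 * t)
      central-on-path i central with toℕ i ≤? suc (2 * t)
      ... | yes i≤ = i≤
      ... | no i≰  = ⊥-elim (edge-crosses-parts fzero i (spider1-leaf-edge _ fzero i refl (≰⇒> i≰)) (sym central))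

      central-half≤ : ∀ i → part (F i) ≡ q₀ → ⌊ toℕ i /2⌋ ≤ t
      central-half≤ i central = m≤1+2n⇒⌊m/2⌋≤n t (central-on-path i central)

      -- Two central vertices with the same half-index would be consecutive on the path.
      central-injective : ∀ {i i'} → part (F i) ≡ q₀ → part (F i') ≡ q₀ →
                          ⌊ toℕ i /2⌋ ≡ ⌊ toℕ i' /2⌋ → i ≡ i'
      central-injective {i} {i'} central central' halves≡ with <-cmp (toℕ i) (toℕ i')
      ... | tri≈ _ i≡i' _ = toℕ-injective i≡i'
      ... | tri< i<i' _ _ = ⊥-elim (edge-crosses-parts i i'
            (spider1-path-edge _ i i' (m<n∧⌊m/2⌋≡⌊n/2⌋⇒n≡1+m i<i' halves≡) (central-on-path i' central'))
            (trans central (sym central')))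
      ... | tri> _ _ i'<i = ⊥-elim (edge-crosses-parts i' i
            (spider1-path-edge _ i' i (m<n∧⌊m/2⌋≡⌊n/2⌋⇒n≡1+m i'<i (sym halves≡)) (central-on-path i central))
            (trans central' (sym central)))

      -- Relabelling parts by the transposition (q₀ j) gives the other parts the codes below j k;
      -- the centre's part, indexed by half the path position, takes the codes j k, …, j k + t.
      code : Fin (suc p) → ℕ
      code i with part (F i) ≟ q₀
      ... | yes _ = j * k + ⌊ toℕ i /2⌋
      ... | no _  = transpose q₀ j (part (F i)) * k + slot (F i)

      transpose-<j : ∀ i → part (F i) ≢ q₀ → transpose q₀ j (part (F i)) < j
      transpose-<j i = transpose-< (≤-pred (part< fzero)) (≤-pred (part< i))

      code-< : ∀ i → code i < p
      code-< i with part (F i) ≟ q₀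
      ... | yes central = s≤s (begin
        j * k + ⌊ toℕ i /2⌋ ≤⟨ +-monoʳ-≤ (j * k) (central-half≤ i central) ⟩
        j * k + t          ≡⟨ +-comm (j * k) t ⟩
        t + j * k          ∎)
        where open ≤-Reasoning
      ... | no peripheral = begin-strict
        τ * k + slot (F i) <⟨ +-monoʳ-< (τ * k) (m%n<n (F i ∸ p) k) ⟩
        τ * k + k          ≡⟨ +-comm (τ * k) k ⟩
        suc τ * k          ≤⟨ *-monoˡ-≤ k (transpose-<j i peripheral) ⟩
        j * k              ≤⟨ m≤n+m (j * k) t ⟩
        t + j * k          <⟨ n<1+n _ ⟩
        p                  ∎
        where
        open ≤-Reasoning
        τ = transpose q₀ j (part (F i))

      code-injective : Injective _≡_ _≡_ code
      code-injective {i} {i'} eq with part (F i) ≟ q₀ | part (F i') ≟ q₀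
      ... | yes central | yes central' = central-injective central central' (+-cancelˡ-≡ (j * k) _ _ eq)
      ... | yes central | no peripheral' = ⊥-elim (<-irrefl
            (sym (proj₁ (*+-injective k (≤-<-trans (central-half≤ i central) t<k) (m%n<n (F i' ∸ p) k) eq)))
            (transpose-<j i' peripheral'))
      ... | no peripheral | yes central' = ⊥-elim (<-irrefl
            (proj₁ (*+-injective k (m%n<n (F i ∸ p) k) (≤-<-trans (central-half≤ i' central') t<k) eq))
            (transpose-<j i peripheral))
      ... | no _ | no _ with *+-injective k (m%n<n (F i ∸ p) k) (m%n<n (F i' ∸ p) k) eq
      ...   | τ≡ , slots≡ = F-injective
              (part-slot-injective (all-outside i) (all-outside i') (transpose-injective q₀ j τ≡) slots≡)

  spider-free : ∀ {N} → N ≤ p + suc j * k → ¬ (spider1 (suc p) (2 * t) ⊆G graph N)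
  spider-free N≤ (f , f-inj , f-edge) = centre-not-outside-clique (≮⇒≥ centre-not-in-clique)
    where open SpiderEmbedding N≤ f f-inj f-edge

spider-wheel-lower-bound : ∀ {m n} k t j .{{_ : NonZero k}} → t < k → 2 * k ≤ m →
  n ≡ suc (suc (t + j * k)) → RamseyGeq (spider1 n (2 * t)) (wheel m) (2 * n + k ∸ t ∸ 2)
spider-wheel-lower-bound {m} k t j t<k 2k≤m refl =
  critical-graphs⇒RamseyGeq {G = spider1 (suc p) (2 * t)} {H = wheel m}
    λ N N< → graph N , spider-free (≤-pred (subst (N <_) order≡ N<)) , wheel-free 2k≤m
  where
  open SpiderFree k t j t<k
  open CliqueAndMultipartite p k
  open ≡-Reasoning

  expand : ∀ t x k → 2 * suc (suc (t + x)) + k ≡ t + 2 + suc (suc (t + x) + (k + x))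
  expand = solve-∀

  order≡ : 2 * suc p + k ∸ t ∸ 2 ≡ suc (p + suc j * k)
  order≡ = begin
    2 * suc p + k ∸ t ∸ 2                  ≡⟨ ∸-+-assoc (2 * suc p + k) t 2 ⟩
    2 * suc p + k ∸ (t + 2)                ≡⟨ cong (_∸ (t + 2)) (expand t (j * k) k) ⟩
    t + 2 + suc (p + suc j * k) ∸ (t + 2)  ≡⟨ m+n∸m≡n (t + 2) _ ⟩
    suc (p + suc j * k)                    ∎

theorem4 : (m t n : ℕ) → 8 ≤ m → 2 ∣ m → .{{_ : NonZero (m / 2)}} →
    1 ≤ t → t ≤ m / 2 ∸ 2 → 1 ≤ n → 2 * t + 2 ≤ n →
    n % (m / 2) ≡ (t + 2) % (m / 2) →
    RamseyGeq (spider1 n (2 * t)) (wheel m) (2 * n + m / 2 ∸ t ∸ 2)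
theorem4 m t n _ 2∣m _ t≤k∸2 _ 2t+2≤n n%k≡[t+2]%k = spider-wheel-lower-bound k t j t<k 2k≤m n≡2+t+jk
  where
  k = m / 2
  j = n / k ∸ (t + 2) / k

  t<k : t < k
  t<k = ≤-<-trans t≤k∸2 (≤-<-trans (∸-monoʳ-≤ k (s≤s z≤n)) (∸-monoʳ-< z<s (>-nonZero⁻¹ k)))

  2k≤m : 2 * k ≤ m
  2k≤m = ≤-reflexive (trans (*-comm 2 k) (m/n*n≡m 2∣m))

  t+2+x≡2+t+x : ∀ t x → t + 2 + x ≡ suc (suc (t + x))
  t+2+x≡2+t+x = solve-∀

  n≡2+t+jk : n ≡ suc (suc (t + j * k))
  n≡2+t+jk = trans (m%k≡n%k⇒n≡m+[n/k∸m/k]*k k (≤-trans (+-monoˡ-≤ 2 (m≤m+n t _)) 2t+2≤n) n%k≡[t+2]%k)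
                   (t+2+x≡2+t+x t (j * k))
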